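{- Let $S=(s_1,s_2,\ldots)$ be a doubly fractal sequence. Define the positive integer $n$ as follows: if $s_2\neq 1$, let $n$ be the largest integer $k$ such that $s_j=j$ for all $1\le j\le k$ (so that $S$ begins $(1,2,\ldots,n,1)$); if $s_2=1$, let $n$ be the number of leading terms of $S$ equal to $1$ (so that $S$ begins with $n$ ones followed by $2$). Then there are infinitely many distinct signature sequences whose first $n+2$ terms coincide with the first $n+2$ terms $(s_1,\ldots,s_{n+2})$ of $S$.
   Context: All sequences are sequences of positive integers. Suppose every positive integer occurs in $S$. The upper trimmed subsequence $\wedge_S$ is the sequence that remains after the first occurrence of every positive integer is removed from $S$. The lower trimmed subsequence $\vee_S$ is the sequence that remains after $1$ is subtracted from every term of $S$ and then all terms equal to $0$ are removed. $S$ is doubly fractal if $s_1=1$ and $\wedge_S=\vee_S=S$. For a positive real $\theta$, let $M_\theta$ be the multiset $\{i+j\theta : i,j\in\mathbb{N}\}$ ($\mathbb{N}$ the positive integers), arranged in nondecreasing order (repeated values, which occur exactly when $\theta$ is rational, listed with multiplicity) as $(s'_h+a_h\theta)_{h\ge1}$ with $s'_h,a_h\in\mathbb{N}$; the signature sequence of $\theta$ is $S_\theta=(s'_1,s'_2,\ldots)$. A signature sequence is a sequence of the form $S_\theta$ for some positive real $\theta$. -}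

module Defs where

open import Level using (0ℓ)
open import Data.Nat as ℕ using (ℕ; zero; suc; _≤_; _<_; compare; less; equal; greater)
open import Data.Integer as ℤ using (ℤ)
open import Data.Rational as ℚ using (ℚ; _/_)
open import Data.Product using (Σ; ∃; _×_; _,_; proj₁)
open import Data.List using (List)
open import Data.List.Relation.Unary.All using (All)
open import Relation.Nullary using (¬_)
open import Relation.Binary.PropositionalEquality using (_≡_; _≢_)

-- Sequences of positive integers are functions ℕ → ℕ, indexed from 0:
-- the paper's s_k is  S (k - 1).
Seq : Set
Seq = ℕ → ℕ

StrictlyIncreasing : (ℕ → ℕ) → Set
StrictlyIncreasing f = ∀ k → f k < f (suc k)

FirstOcc : Seq → ℕ → Set
FirstOcc S i = ∀ k → k < i → S k ≢ S i

Admissible : Seq → Set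
Admissible S = (∀ k → 1 ≤ S k) × (∀ m → 1 ≤ m → ∃ λ k → S k ≡ m)

-- ∧_S = S : the subsequence of S at the non-first-occurrence positions,
-- enumerated in increasing order by f, is S itself.
UpperTrimEq : Seq → Set
UpperTrimEq S = Σ (ℕ → ℕ) λ f →
    StrictlyIncreasing f
  × (∀ k → ¬ FirstOcc S (f k))
  × (∀ i → ¬ FirstOcc S i → ∃ λ k → f k ≡ i)
  × (∀ k → S (f k) ≡ S k)

-- ∨_S = S : subtract 1 from every term, delete the zeros (i.e. keep positions
-- with S i ≥ 2, enumerated in increasing order by g); the result is S.
LowerTrimEq : Seq → Set
LowerTrimEq S = Σ (ℕ → ℕ) λ g →
    StrictlyIncreasing g
  × (∀ k → 2 ≤ S (g k))
  × (∀ i → 2 ≤ S i → ∃ λ k → g k ≡ i)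
  × (∀ k → S (g k) ℕ.∸ 1 ≡ S k)

DoublyFractal : Seq → Set
DoublyFractal S = Admissible S × (S 0 ≡ 1) × UpperTrimEq S × LowerTrimEq S

-- Positive real numbers as (open) Dedekind lower cuts in ℚ:
-- q ∈ cut  means  q < θ.
record PosReal : Set₁ where
  field
    cut      : ℚ → Set
    pos      : cut ℚ.0ℚ
    bounded  : ∃ λ q → ¬ cut q
    downward : ∀ p q → p ℚ.≤ q → cut q → cut p
    rounded  : ∀ q → cut q → ∃ λ r → (q ℚ.< r) × cut r

open PosReal public

_≤ʳ_ : ℚ → PosReal → Set
q ≤ʳ θ = ∀ r → r ℚ.< q → cut θ r

_ʳ≤_ : PosReal → ℚ → Set
θ ʳ≤ q = ¬ cut θ q

diffℤ : ℕ → ℕ → ℤ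
diffℤ a b = ℤ.+ a ℤ.- ℤ.+ b

-- i + j θ ≤ i' + j' θ
ValLe : PosReal → ℕ × ℕ → ℕ × ℕ → Set
ValLe θ (i , j) (i' , j') with compare j j'
-- j' = j + (k+1):  i - i' ≤ (k+1) θ
... | less _ k    = (diffℤ i i' / suc k) ≤ʳ θ
... | equal _     = i ≤ i'
-- j = j' + (k+1):  (k+1) θ ≤ i' - i
... | greater _ k = θ ʳ≤ (diffℤ i' i / suc k)

-- T is the signature sequence of θ: the multiset {i + jθ : i,j ≥ 1} is listed
-- (with multiplicity, i.e. via a bijection h ↦ e h = (s'_h , a_h) onto the
-- pairs of positive integers) in nondecreasing order, and T h = s'_h.
IsSignatureOf : PosReal → Seq → Set
IsSignatureOf θ T = Σ (ℕ → ℕ × ℕ) λ e →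
    (∀ h → 1 ≤ proj₁ (e h) × 1 ≤ Data.Product.proj₂ (e h))
  × (∀ h h' → e h ≡ e h' → h ≡ h')
  × (∀ i j → 1 ≤ i → 1 ≤ j → ∃ λ h → e h ≡ (i , j))
  × (∀ h → ValLe θ (e h) (e (suc h)))
  × (∀ h → T h ≡ proj₁ (e h))

IsSignatureSequence : Seq → Set₁
IsSignatureSequence T = Σ PosReal λ θ → IsSignatureOf θ T

PrefixId : Seq → ℕ → Set
PrefixId S k = ∀ j → j < k → S j ≡ suc j

TheN : Seq → ℕ → Set
TheN S n =
    (S 1 ≢ 1 × PrefixId S n × (∀ k → PrefixId S k → k ≤ n))
  Data.Sum.⊎
    (S 1 ≡ 1 × (∀ j → j < n → S j ≡ 1) × S n ≢ 1)
  where import Data.Sum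

AgreeBelow : ℕ → Seq → Seq → Set
AgreeBelow m T S = ∀ j → j < m → T j ≡ S j

Differ : Seq → Seq → Set
Differ T U = ∃ λ k → T k ≢ U k

-- For θ = P / Q, comparing i + j θ amounts to comparing the integer key Q i + P j, so the
-- signature sequence of a fraction is read off a listing of the positive pairs by key (ties
-- broken by the second coordinate). The upper and lower trims force a doubly fractal S to
-- begin (1, 2, …, N, 1, N + 1) or with N ones followed by (2, 1), for some N ≥ 2. For
-- θₘ = (N - 1) + 1 / (m + 2) the listing begins (1,1), …, (N,1), (1,2), (N+1,1); its first
-- coordinates form the signature sequence of θₘ and its second coordinates that of 1 / θₘ,
-- matching S up to N + 2 in the two cases respectively. Different fractions have different
-- signature sequences, because (1, Q + 1) and (P + 1, 1) tie at P / Q but are strictly ordered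
-- at any smaller fraction. So the θₘ yield an infinite pairwise distinct family of signature
-- sequences, and such a family avoids any finite list.

module Submission where

open import Defs
open import Data.Nat using (ℕ; _+_)
open import Data.Product using (Σ; _×_)
open import Data.List using (List)
open import Data.List.Relation.Unary.All using (All)

open import Data.Empty using (⊥-elim)
open import Data.Integer as ℤ using (ℤ; _⊖_)
import Data.Integer.Properties as ℤP
import Data.Integer.Tactic.RingSolver as ℤSolver
open import Data.List using ([]; _∷_; foldr; applyUpTo; cartesianProduct)
open import Data.List.Membership.Propositional using (_∈_)
open import Data.List.Membership.Propositional.Properties
  using (∈-cartesianProduct⁺; ∈-cartesianProduct⁻; ∈-applyUpTo⁺; ∈-applyUpTo⁻)
open import Data.List.Relation.Unary.All using ([]; _∷_)
open import Data.List.Relation.Unary.Any using (here; there)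
open import Data.Nat as ℕ
  using (zero; suc; _*_; _∸_; _⊔_; _≤_; _<_; z≤n; s≤s; compare; less; equal; greater)
import Data.Nat.Properties as ℕP
open import Data.Nat.Tactic.RingSolver using (solve-∀)
open import Data.Product using (∃; _,_; proj₁; proj₂; swap; map₂)
open import Data.Rational as ℚ using (_/_)
import Data.Rational.Properties as ℚP
import Data.Rational.Unnormalised as ℚᵘ
import Data.Rational.Unnormalised.Properties as ℚᵘP
open import Data.Sum using (_⊎_; inj₁; inj₂; [_,_]′)
open import Function using (_∘_)
open import Relation.Binary using (tri<; tri≈; tri>)
open import Relation.Binary.PropositionalEquality
open import Relation.Nullary using (¬_; Dec; yes; no; contradiction)

-- Fractions as positive reals

*≤*⇒/≤/ : ∀ (a c : ℤ) (k l : ℕ) → a ℤ.* ℤ.+ suc l ℤ.≤ c ℤ.* ℤ.+ suc k → a / suc k ℚ.≤ c / suc l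
*≤*⇒/≤/ a c k l a*l≤c*k = ℚP.toℚᵘ-cancel-≤
  (ℚᵘP.≤-respˡ-≃ (ℚᵘP.≃-sym (ℚP.toℚᵘ-fromℚᵘ (ℚᵘ.mkℚᵘ a k)))
    (ℚᵘP.≤-respʳ-≃ (ℚᵘP.≃-sym (ℚP.toℚᵘ-fromℚᵘ (ℚᵘ.mkℚᵘ c l))) (ℚᵘ.*≤* a*l≤c*k)))

fraction : ℕ → ℕ → PosReal
fraction p q = record
  { cut      = λ r → r ℚ.< θ
  ; pos      = ℚP.positive⁻¹ θ {{ℚP.normalize-pos (suc p) (suc q)}}
  ; bounded  = θ , ℚP.<-irrefl refl
  ; downward = λ _ _ → ℚP.≤-<-trans
  ; rounded  = λ _ r<θ → ℚP.<-dense r<θ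
  }
  where
  θ : ℚ.ℚ
  θ = ℤ.+ suc p / suc q

diffℤ-* : ∀ a b c → diffℤ a b ℤ.* ℤ.+ c ≡ (c * a) ⊖ (c * b)
diffℤ-* a b c = begin
  (ℤ.+ a ℤ.- ℤ.+ b) ℤ.* ℤ.+ c            ≡⟨ distrib (ℤ.+ a) (ℤ.+ b) (ℤ.+ c) ⟩
  ℤ.+ c ℤ.* ℤ.+ a ℤ.- ℤ.+ c ℤ.* ℤ.+ b    ≡⟨ cong₂ ℤ._-_ (sym (ℤP.pos-* c a)) (sym (ℤP.pos-* c b)) ⟩
  ℤ.+ (c * a) ℤ.- ℤ.+ (c * b)            ≡⟨ ℤP.m-n≡m⊖n (c * a) (c * b) ⟩
  (c * a) ⊖ (c * b)                      ∎
  where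
  open ≡-Reasoning
  distrib : ∀ x y z → (x ℤ.- y) ℤ.* z ≡ z ℤ.* x ℤ.- z ℤ.* y
  distrib = ℤSolver.solve-∀

m⊖n≤o : ∀ {m n o} → m ≤ n + o → m ⊖ n ℤ.≤ ℤ.+ o
m⊖n≤o {m} {n} {o} m≤n+o = ℤP.≤-trans (ℤP.⊖-monoˡ-≤ n m≤n+o)
  (ℤP.≤-reflexive (trans (ℤP.≤-⊖ (ℕP.m≤m+n n o)) (cong ℤ.+_ (ℕP.m+n∸m≡n n o))))

o≤m⊖n : ∀ {m n o} → n + o ≤ m → ℤ.+ o ℤ.≤ m ⊖ n
o≤m⊖n {m} {n} {o} n+o≤m = ℤP.≤-trans
  (ℤP.≤-reflexive (sym (trans (ℤP.≤-⊖ (ℕP.m≤m+n n o)) (cong ℤ.+_ (ℕP.m+n∸m≡n n o)))))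
  (ℤP.⊖-monoˡ-≤ n n+o≤m)

split-suc-+ : ∀ P Q a b k → Q * a + P * suc (b + k) ≡ (Q * a + P * suc k) + P * b
split-suc-+ = solve-∀

-- Listing the positive pairs by value

Pair : Set
Pair = ℕ × ℕ

module Key (p q : ℕ) where
  P Q : ℕ
  P = suc p
  Q = suc q

  key : Pair → ℕ
  key (i , j) = Q * i + P * j

  key-≤⇒ValLe : ∀ x y → key x ≤ key y → ValLe (fraction p q) x y
  key-≤⇒ValLe (i , j) (i' , j') ≤-key with compare j j'
  ... | less .j k = λ r r<d → ℚP.<-≤-trans r<d (*≤*⇒/≤/ (diffℤ i i') (ℤ.+ P) k q (begin
    diffℤ i i' ℤ.* ℤ.+ Q   ≡⟨ diffℤ-* i i' Q ⟩
    (Q * i) ⊖ (Q * i')     ≤⟨ m⊖n≤o Qi≤Qi'+P[1+k] ⟩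
    ℤ.+ (P * suc k)        ≡⟨ ℤP.pos-* P (suc k) ⟩
    ℤ.+ P ℤ.* ℤ.+ suc k    ∎))
    where
    open ℤP.≤-Reasoning
    Qi≤Qi'+P[1+k] : Q * i ≤ Q * i' + P * suc k
    Qi≤Qi'+P[1+k] = ℕP.+-cancelʳ-≤ (P * j) _ _ (subst (key (i , j) ≤_) (split-suc-+ P Q i' j k) ≤-key)
  ... | equal .j = ℕP.*-cancelˡ-≤ Q (ℕP.+-cancelʳ-≤ (P * j) _ _ ≤-key)
  ... | greater .j' k = λ d<θ → ℚP.<-irrefl refl (ℚP.≤-<-trans θ≤d d<θ)
    where
    open ℤP.≤-Reasoning
    Qi+P[1+k]≤Qi' : Q * i + P * suc k ≤ Q * i'
    Qi+P[1+k]≤Qi' = ℕP.+-cancelʳ-≤ (P * j') _ _ (subst (_≤ key (i' , j')) (split-suc-+ P Q i j' k) ≤-key)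
    θ≤d : ℤ.+ P / Q ℚ.≤ diffℤ i' i / suc k
    θ≤d = *≤*⇒/≤/ (ℤ.+ P) (diffℤ i' i) q k (begin
      ℤ.+ P ℤ.* ℤ.+ suc k    ≡⟨ ℤP.pos-* P (suc k) ⟨
      ℤ.+ (P * suc k)        ≤⟨ o≤m⊖n Qi+P[1+k]≤Qi' ⟩
      (Q * i') ⊖ (Q * i)     ≡⟨ diffℤ-* i' i Q ⟨
      diffℤ i' i ℤ.* ℤ.+ Q   ∎)

origin : Pair
origin = 1 , 1

PosPair : Pair → Set
PosPair (i , j) = 1 ≤ i × 1 ≤ j

module Enumeration (p q : ℕ) where
  open Key p q public

  infix 4 _≺_ _≼_
  data _≺_ (x y : Pair) : Set where
    key< : key x < key y → x ≺ y
    key≡ : key x ≡ key y → proj₂ x < proj₂ y → x ≺ y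

  _≼_ : Pair → Pair → Set
  x ≼ y = x ≺ y ⊎ x ≡ y

  ≺⇒key≤ : ∀ {x y} → x ≺ y → key x ≤ key y
  ≺⇒key≤ (key< k<k') = ℕP.<⇒≤ k<k'
  ≺⇒key≤ (key≡ k≡k' _) = ℕP.≤-reflexive k≡k'

  ≼⇒key≤ : ∀ {x y} → x ≼ y → key x ≤ key y
  ≼⇒key≤ (inj₁ x≺y) = ≺⇒key≤ x≺y
  ≼⇒key≤ (inj₂ refl) = ℕP.≤-refl

  ≺-irrefl : ∀ {x} → ¬ x ≺ x
  ≺-irrefl (key< k<k) = ℕP.<-irrefl refl k<k
  ≺-irrefl (key≡ _ j<j) = ℕP.<-irrefl refl j<j

  ≺-trans : ∀ {x y z} → x ≺ y → y ≺ z → x ≺ z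
  ≺-trans (key< k<k') (key< k'<k'') = key< (ℕP.<-trans k<k' k'<k'')
  ≺-trans {x} (key< k<k') (key≡ k'≡k'' _) = key< (subst (key x <_) k'≡k'' k<k')
  ≺-trans {z = z} (key≡ k≡k' _) (key< k'<k'') = key< (subst (_< key z) (sym k≡k') k'<k'')
  ≺-trans (key≡ k≡k' j<j') (key≡ k'≡k'' j'<j'') = key≡ (trans k≡k' k'≡k'') (ℕP.<-trans j<j' j'<j'')

  ≺-asym : ∀ {x y} → x ≺ y → ¬ y ≺ x
  ≺-asym x≺y y≺x = ≺-irrefl (≺-trans x≺y y≺x)

  ≺-≼-trans : ∀ {x y z} → x ≺ y → y ≼ z → x ≺ z
  ≺-≼-trans x≺y (inj₁ y≺z) = ≺-trans x≺y y≺z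
  ≺-≼-trans x≺y (inj₂ refl) = x≺y

  ≼-≺-trans : ∀ {x y z} → x ≼ y → y ≺ z → x ≺ z
  ≼-≺-trans (inj₁ x≺y) y≺z = ≺-trans x≺y y≺z
  ≼-≺-trans (inj₂ refl) y≺z = y≺z

  ≼-trans : ∀ {x y z} → x ≼ y → y ≼ z → x ≼ z
  ≼-trans (inj₁ x≺y) y≼z = inj₁ (≺-≼-trans x≺y y≼z)
  ≼-trans (inj₂ refl) y≼z = y≼z

  key-injective : ∀ {x y} → key x ≡ key y → proj₂ x ≡ proj₂ y → x ≡ y
  key-injective {i , j} {i' , .j} k≡k' refl =
    cong (_, j) (ℕP.*-cancelˡ-≡ i i' Q (ℕP.+-cancelʳ-≡ _ _ _ k≡k'))

  ≺-total : ∀ x y → x ≺ y ⊎ x ≡ y ⊎ y ≺ x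
  ≺-total x y with ℕP.<-cmp (key x) (key y)
  ... | tri< k<k' _ _ = inj₁ (key< k<k')
  ... | tri> _ _ k>k' = inj₂ (inj₂ (key< k>k'))
  ... | tri≈ _ k≡k' _ with ℕP.<-cmp (proj₂ x) (proj₂ y)
  ...   | tri< j<j' _ _ = inj₁ (key≡ k≡k' j<j')
  ...   | tri≈ _ j≡j' _ = inj₂ (inj₁ (key-injective k≡k' j≡j'))
  ...   | tri> _ _ j>j' = inj₂ (inj₂ (key≡ (sym k≡k') j>j'))

  _≺?_ : ∀ x y → Dec (x ≺ y)
  x ≺? y with ≺-total x y
  ... | inj₁ x≺y = yes x≺y
  ... | inj₂ (inj₁ refl) = no ≺-irrefl
  ... | inj₂ (inj₂ y≺x) = no (≺-asym y≺x)

  ⊀⇒≽ : ∀ {x y} → ¬ x ≺ y → y ≼ x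
  ⊀⇒≽ {x} {y} x⊀y with ≺-total x y
  ... | inj₁ x≺y = contradiction x≺y x⊀y
  ... | inj₂ (inj₁ x≡y) = inj₂ (sym x≡y)
  ... | inj₂ (inj₂ y≺x) = inj₁ y≺x

  ≺⇒proj₂< : ∀ {u v} → proj₁ u ≡ proj₁ v → u ≺ v → proj₂ u < proj₂ v
  ≺⇒proj₂< {i , j} {.i , j'} refl (key< k<k') = ℕP.*-cancelˡ-< P j j' (ℕP.+-cancelˡ-< (Q * i) _ _ k<k')
  ≺⇒proj₂< refl (key≡ _ j<j') = j<j'

  proj₂<⇒≺ : ∀ {u v} → proj₁ u ≡ proj₁ v → proj₂ u < proj₂ v → u ≺ v
  proj₂<⇒≺ {i , j} {.i , j'} refl j<j' = key< (ℕP.+-monoʳ-< (Q * i) (ℕP.*-monoʳ-< P j<j'))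

  ≺⇒proj₁< : ∀ {u v} → proj₂ u ≡ proj₂ v → u ≺ v → proj₁ u < proj₁ v
  ≺⇒proj₁< {i , j} {i' , .j} refl (key< k<k') = ℕP.*-cancelˡ-< Q i i' (ℕP.+-cancelʳ-< (P * j) _ _ k<k')
  ≺⇒proj₁< refl (key≡ _ j<j) = contradiction j<j (ℕP.<-irrefl refl)

  proj₁<⇒≺ : ∀ {u v} → proj₂ u ≡ proj₂ v → proj₁ u < proj₁ v → u ≺ v
  proj₁<⇒≺ {i , j} {i' , .j} refl i<i' = key< (ℕP.+-monoˡ-< (P * j) (ℕP.*-monoʳ-< Q i<i'))

  ≼⇒proj₁≤ : ∀ {u v} → proj₂ u ≡ proj₂ v → u ≼ v → proj₁ u ≤ proj₁ v
  ≼⇒proj₁≤ j≡j' (inj₁ u≺v) = ℕP.<⇒≤ (≺⇒proj₁< j≡j' u≺v)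
  ≼⇒proj₁≤ _ (inj₂ refl) = ℕP.≤-refl

  proj₁≤key : ∀ x → proj₁ x ≤ key x
  proj₁≤key (i , j) = ℕP.≤-trans (ℕP.m≤n*m i Q) (ℕP.m≤m+n (Q * i) (P * j))

  proj₂≤key : ∀ x → proj₂ x ≤ key x
  proj₂≤key (i , j) = ℕP.≤-trans (ℕP.m≤n*m j P) (ℕP.m≤n+m (P * j) (Q * i))

  ⊀origin : ∀ {z} → PosPair z → ¬ z ≺ origin
  ⊀origin (1≤i , 1≤j) (key< k<k') =
    ℕP.<⇒≱ k<k' (ℕP.+-mono-≤ (ℕP.*-monoʳ-≤ Q 1≤i) (ℕP.*-monoʳ-≤ P 1≤j))
  ⊀origin (_ , 1≤j) (key≡ _ j<1) = ℕP.<⇒≱ j<1 1≤j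

  origin≼ : ∀ {z} → PosPair z → origin ≼ z
  origin≼ z⁺ = ⊀⇒≽ (⊀origin z⁺)

  code : Pair → ℕ
  code x = key x * key x + proj₂ x

  ≺⇒code< : ∀ {x y} → x ≺ y → code x < code y
  ≺⇒code< {x} {y} (key< kx<ky) = begin-strict
    key x * key x + proj₂ x   ≤⟨ ℕP.+-monoʳ-≤ (key x * key x) (proj₂≤key x) ⟩
    key x * key x + key x     <⟨ ℕP.m≤m+n (suc (key x * key x + key x)) (key x) ⟩
    suc (key x * key x + key x) + key x ≡⟨ square-suc (key x) ⟨
    suc (key x) * suc (key x) ≤⟨ ℕP.*-mono-≤ kx<ky kx<ky ⟩
    key y * key y             ≤⟨ ℕP.m≤m+n (key y * key y) (proj₂ y) ⟩
    code y                    ∎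
    where
    open ℕP.≤-Reasoning
    square-suc : ∀ k → suc k * suc k ≡ suc (k * k + k) + k
    square-suc = solve-∀
  ≺⇒code< {x} {y} (key≡ kx≡ky jx<jy) =
    subst (λ k → code x < k * k + proj₂ y) kx≡ky (ℕP.+-monoʳ-< (key x * key x) jx<jy)

  pairsUpTo : ℕ → List Pair
  pairsUpTo K = cartesianProduct (applyUpTo suc K) (applyUpTo suc K)

  ∈-pairsUpTo : ∀ {K z} → PosPair z → proj₁ z ≤ K → proj₂ z ≤ K → z ∈ pairsUpTo K
  ∈-pairsUpTo {z = suc i , suc j} _ i<K j<K =
    ∈-cartesianProduct⁺ (∈-applyUpTo⁺ suc i<K) (∈-applyUpTo⁺ suc j<K)

  pairsUpTo-pos : ∀ {K z} → z ∈ pairsUpTo K → PosPair z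
  pairsUpTo-pos {K} z∈ with ∈-cartesianProduct⁻ (applyUpTo suc K) (applyUpTo suc K) z∈
  ... | i∈ , j∈ with ∈-applyUpTo⁻ suc i∈ | ∈-applyUpTo⁻ suc j∈
  ...   | _ , _ , refl | _ , _ , refl = s≤s z≤n , s≤s z≤n

  Above : Pair → Pair → Set
  Above x r = x ≺ r × PosPair r

  module _ (x : Pair) where
    pick : Pair → Pair → Pair
    pick z r with x ≺? z | z ≺? r
    ... | yes _ | yes _ = z
    ... | _     | _     = r

    pick-≼ʳ : ∀ z r → pick z r ≼ r
    pick-≼ʳ z r with x ≺? z | z ≺? r
    ... | yes _ | yes z≺r = inj₁ z≺r
    ... | yes _ | no _    = inj₂ refl
    ... | no _  | _       = inj₂ refl

    pick-≼ˡ : ∀ z r → x ≺ z → pick z r ≼ z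
    pick-≼ˡ z r x≺z with x ≺? z | z ≺? r
    ... | yes _ | yes _   = inj₂ refl
    ... | yes _ | no z⊀r  = ⊀⇒≽ z⊀r
    ... | no x⊀z | _      = contradiction x≺z x⊀z

    pick-above : ∀ z r → PosPair z → Above x r → Above x (pick z r)
    pick-above z r z⁺ r-above with x ≺? z | z ≺? r
    ... | yes x≺z | yes _ = x≺z , z⁺
    ... | yes _   | no _  = r-above
    ... | no _    | _     = r-above

    lowest : Pair → List Pair → Pair
    lowest r = foldr pick r

    lowest-≼ : ∀ r zs → lowest r zs ≼ r
    lowest-≼ r [] = inj₂ refl
    lowest-≼ r (z ∷ zs) = ≼-trans (pick-≼ʳ z _) (lowest-≼ r zs)

    lowest-≼-∈ : ∀ r {zs z} → z ∈ zs → x ≺ z → lowest r zs ≼ z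
    lowest-≼-∈ r (here refl) x≺z = pick-≼ˡ _ _ x≺z
    lowest-≼-∈ r (there z∈) x≺z = ≼-trans (pick-≼ʳ _ _) (lowest-≼-∈ r z∈ x≺z)

    lowest-above : ∀ r zs → Above x r → (∀ {z} → z ∈ zs → PosPair z) → Above x (lowest r zs)
    lowest-above r [] r-above _ = r-above
    lowest-above r (z ∷ zs) r-above zs⁺ =
      pick-above z _ (zs⁺ (here refl)) (lowest-above r zs r-above (zs⁺ ∘ there))

  right : Pair → Pair
  right (i , j) = suc i , j

  opaque
    -- A pair between x and right x has both coordinates at most key (right x),
    -- so searching pairsUpTo (key (right x)) finds the least pair above x.
    successor : Pair → Pair
    successor x = lowest x (right x) (pairsUpTo (key (right x)))

    successor-above : ∀ {x} → PosPair x → Above x (successor x)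
    successor-above {x} (_ , 1≤j) = lowest-above x (right x) (pairsUpTo (key (right x)))
      (proj₁<⇒≺ refl (ℕP.n<1+n _) , s≤s z≤n , 1≤j) (pairsUpTo-pos {key (right x)})

    successor-least : ∀ {x z} → PosPair z → x ≺ z → successor x ≼ z
    successor-least {x} {z} z⁺ x≺z with ≺-total z (right x)
    ... | inj₁ z≺r = lowest-≼-∈ x (right x) {pairsUpTo (key (right x))}
            (∈-pairsUpTo z⁺ (ℕP.≤-trans (proj₁≤key z) kz≤kr) (ℕP.≤-trans (proj₂≤key z) kz≤kr)) x≺z
      where
      kz≤kr : key z ≤ key (right x)
      kz≤kr = ≺⇒key≤ z≺r
    ... | inj₂ (inj₁ refl) = lowest-≼ x (right x) (pairsUpTo (key (right x)))
    ... | inj₂ (inj₂ r≺z) = inj₁ (≼-≺-trans (lowest-≼ x (right x) (pairsUpTo (key (right x)))) r≺z)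

  e : ℕ → Pair
  e zero = origin
  e (suc h) = successor (e h)

  e-pos : ∀ h → PosPair (e h)
  e-pos zero = s≤s z≤n , s≤s z≤n
  e-pos (suc h) = proj₂ (successor-above (e-pos h))

  e-≺-suc : ∀ h → e h ≺ e (suc h)
  e-≺-suc h = proj₁ (successor-above (e-pos h))

  e-mono : ∀ {h h'} → h < h' → e h ≺ e h'
  e-mono {h} {suc h'} (s≤s h≤h') with ℕP.m≤n⇒m<n∨m≡n h≤h'
  ... | inj₁ h<h' = ≺-trans (e-mono h<h') (e-≺-suc h')
  ... | inj₂ refl = e-≺-suc h

  e-≺⇒< : ∀ {h h'} → e h ≺ e h' → h < h'
  e-≺⇒< {h} {h'} e≺e with ℕP.<-cmp h h'
  ... | tri< h<h' _ _ = h<h'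
  ... | tri≈ _ refl _ = contradiction e≺e ≺-irrefl
  ... | tri> _ _ h>h' = contradiction e≺e (≺-asym (e-mono h>h'))

  e-injective : ∀ {h h'} → e h ≡ e h' → h ≡ h'
  e-injective {h} {h'} e≡e with ℕP.<-cmp h h'
  ... | tri< h<h' _ _ = contradiction (subst (e h ≺_) (sym e≡e) (e-mono h<h')) ≺-irrefl
  ... | tri≈ _ h≡h' _ = h≡h'
  ... | tri> _ _ h>h' = contradiction (subst (_≺ e h) (sym e≡e) (e-mono h>h')) ≺-irrefl

  h≤code[e[h]] : ∀ h → h ≤ code (e h)
  h≤code[e[h]] zero = z≤n
  h≤code[e[h]] (suc h) = ℕP.≤-<-trans (h≤code[e[h]] h) (≺⇒code< (e-≺-suc h))

  reached-or-above : ∀ {z} → PosPair z → ∀ h → (∃ λ k → e k ≡ z) ⊎ e h ≺ z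
  reached-or-above z⁺ zero with origin≼ z⁺
  ... | inj₁ o≺z = inj₂ o≺z
  ... | inj₂ o≡z = inj₁ (0 , o≡z)
  reached-or-above z⁺ (suc h) with reached-or-above z⁺ h
  ... | inj₁ found = inj₁ found
  ... | inj₂ e≺z with successor-least z⁺ e≺z
  ...   | inj₁ e'≺z = inj₂ e'≺z
  ...   | inj₂ e'≡z = inj₁ (suc h , e'≡z)

  -- code is ≺-monotone, so code (e h) ≥ h; hence z is reached by the index code z.
  e-surjective : ∀ {z} → PosPair z → ∃ λ h → e h ≡ z
  e-surjective {z} z⁺ with reached-or-above z⁺ (code z)
  ... | inj₁ found = found
  ... | inj₂ e≺z = contradiction (≺⇒code< e≺z) (ℕP.≤⇒≯ (h≤code[e[h]] (code z)))

  signature₁ : IsSignatureOf (fraction p q) (proj₁ ∘ e)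
  signature₁ = e , e-pos , (λ _ _ → e-injective) , (λ _ _ 1≤i 1≤j → e-surjective (1≤i , 1≤j))
    , (λ h → key-≤⇒ValLe (e h) (e (suc h)) (≺⇒key≤ (e-≺-suc h))) , λ _ → refl

  signature₂ : IsSignatureOf (fraction q p) (proj₂ ∘ e)
  signature₂ = swap ∘ e , (swap ∘ e-pos) , (λ _ _ → e-injective ∘ cong swap)
    , (λ _ _ 1≤i 1≤j → map₂ (cong swap) (e-surjective (1≤j , 1≤i)))
    , (λ h → swapped-ValLe (e h) (e (suc h)) (≺⇒key≤ (e-≺-suc h))) , λ _ → refl
    where
    swapped-ValLe : ∀ x y → key x ≤ key y → ValLe (fraction q p) (swap x) (swap y)
    swapped-ValLe (i , j) (i' , j') ≤-key = Key.key-≤⇒ValLe q p (j , i) (j' , i')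
      (subst₂ _≤_ (ℕP.+-comm (Q * i) (P * j)) (ℕP.+-comm (Q * i') (P * j')) ≤-key)

  e-suc-≡ : ∀ {h y} → PosPair y → e h ≺ y → (∀ {z} → PosPair z → e h ≺ z → ¬ z ≺ y) → e (suc h) ≡ y
  e-suc-≡ {h} y⁺ e≺y nothing-between with successor-least y⁺ e≺y
  ... | inj₂ e'≡y = e'≡y
  ... | inj₁ e'≺y = contradiction e'≺y (nothing-between (e-pos (suc h)) (e-≺-suc h))

  module _ (x : ℕ → Pair) (L : ℕ) (x₀≡origin : x 0 ≡ origin) (x⁺ : ∀ h → h ≤ L → PosPair (x h))
    (sorted : ∀ h → h < L → x h ≺ x (suc h))
    (complete : ∀ {z} → PosPair z → z ≼ x L → ∃ λ i → i ≤ L × x i ≡ z) where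

    sorted-≼ : ∀ {i j} → i ≤ j → j ≤ L → x i ≼ x j
    sorted-≼ {j = zero} z≤n _ = inj₂ refl
    sorted-≼ {i} {suc j} i≤1+j 1+j≤L with ℕP.m≤n⇒m<n∨m≡n i≤1+j
    ... | inj₂ refl = inj₂ refl
    ... | inj₁ (s≤s i≤j) = inj₁ (≼-≺-trans (sorted-≼ i≤j (ℕP.<⇒≤ 1+j≤L)) (sorted j 1+j≤L))

    e-initial : ∀ h → h ≤ L → e h ≡ x h
    e-initial zero _ = sym x₀≡origin
    e-initial (suc h) 1+h≤L =
      e-suc-≡ {h} (x⁺ (suc h) 1+h≤L) (subst (_≺ x (suc h)) (sym eh≡xh) (sorted h 1+h≤L)) nothing-between
      where
      eh≡xh : e h ≡ x h
      eh≡xh = e-initial h (ℕP.<⇒≤ 1+h≤L)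
      nothing-between : ∀ {z} → PosPair z → e h ≺ z → ¬ z ≺ x (suc h)
      nothing-between z⁺ e≺z z≺x with complete z⁺ (inj₁ (≺-≼-trans z≺x (sorted-≼ 1+h≤L ℕP.≤-refl)))
      ... | i , i≤L , refl with i ℕ.≤? h
      ...   | yes i≤h = ≺-irrefl (≺-≼-trans (subst (_≺ x i) eh≡xh e≺z) (sorted-≼ i≤h (ℕP.<⇒≤ 1+h≤L)))
      ...   | no i≰h = ≺-irrefl (≼-≺-trans (sorted-≼ (ℕP.≰⇒> i≰h) i≤L) z≺x)

-- Distinct fractions have distinct signature sequences

Coherent : (Pair → ℕ) → Set
Coherent π = ∀ {p q p' q' u v} → π u ≡ π v → Enumeration._≺_ p q u v → Enumeration._≺_ p' q' u v

proj₁-coherent : Coherent proj₁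
proj₁-coherent {p} {q} {p'} {q'} π≡ u≺v =
  Enumeration.proj₂<⇒≺ p' q' π≡ (Enumeration.≺⇒proj₂< p q π≡ u≺v)

proj₂-coherent : Coherent proj₂
proj₂-coherent {p} {q} {p'} {q'} π≡ u≺v =
  Enumeration.proj₁<⇒≺ p' q' π≡ (Enumeration.≺⇒proj₁< p q π≡ u≺v)

module _ (p₁ q₁ p₂ q₂ : ℕ) where
  private
    module A = Enumeration p₁ q₁
    module B = Enumeration p₂ q₂

  agree-below⇒⊀ : ∀ {h} → (∀ k → k < h → A.e k ≡ B.e k) → ¬ A.e h B.≺ B.e h
  agree-below⇒⊀ {h} agree Ae≺Be with B.e-surjective (A.e-pos h)
  ... | k , Bk≡Ah = ℕP.<-irrefl (A.e-injective (trans (agree k k<h) Bk≡Ah)) k<h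
    where
    k<h : k < h
    k<h = B.e-≺⇒< (subst (B._≺ B.e h) (sym Bk≡Ah) Ae≺Be)

module _ {π} (coherent : Coherent π) (p₁ q₁ p₂ q₂ : ℕ) where
  private
    module A = Enumeration p₁ q₁
    module B = Enumeration p₂ q₂

  agree-step : ∀ {h} → (∀ k → k < h → A.e k ≡ B.e k) → π (A.e h) ≡ π (B.e h) → A.e h ≡ B.e h
  agree-step {h} agree π≡ with B.≺-total (A.e h) (B.e h)
  ... | inj₁ A≺B = contradiction A≺B (agree-below⇒⊀ p₁ q₁ p₂ q₂ agree)
  ... | inj₂ (inj₁ A≡B) = A≡B
  ... | inj₂ (inj₂ B≺A) = contradiction (coherent (sym π≡) B≺A)
          (agree-below⇒⊀ p₂ q₂ p₁ q₁ (λ k k<h → sym (agree k k<h)))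

  differ-or-agree : ∀ h → Differ (π ∘ A.e) (π ∘ B.e) ⊎ (∀ k → k < h → A.e k ≡ B.e k)
  differ-or-agree zero = inj₂ (λ _ ())
  differ-or-agree (suc h) with differ-or-agree h
  ... | inj₁ differ = inj₁ differ
  ... | inj₂ agree with π (A.e h) ℕ.≟ π (B.e h)
  ...   | no π≢ = inj₁ (h , π≢)
  ...   | yes π≡ = inj₂ λ k k<1+h →
          [ agree k , (λ { refl → agree-step agree π≡ }) ]′ (ℕP.m≤n⇒m<n∨m≡n (ℕP.≤-pred k<1+h))

  differ-if-reordered : ∀ {x y} → PosPair x → PosPair y → x A.≺ y → y B.≺ x →
    Differ (π ∘ A.e) (π ∘ B.e)
  differ-if-reordered x⁺ y⁺ x≺y y≺x with A.e-surjective x⁺ | A.e-surjective y⁺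
  ... | a , refl | b , refl with differ-or-agree (suc (a ⊔ b))
  ...   | inj₁ differ = differ
  ...   | inj₂ agree = ⊥-elim (ℕP.<-asym (A.e-≺⇒< {a} x≺y) b<a)
    where
    b<a : b < a
    b<a = B.e-≺⇒< {b} (subst₂ B._≺_ (agree b (s≤s (ℕP.m≤n⊔m a b))) (agree a (s≤s (ℕP.m≤m⊔n a b))) y≺x)

  fractions-differ : suc p₁ * suc q₂ < suc q₁ * suc p₂ → Differ (π ∘ A.e) (π ∘ B.e)
  fractions-differ P₁Q₂<Q₁P₂ = differ-if-reordered (s≤s z≤n , s≤s z≤n) (s≤s z≤n , s≤s z≤n) x≺₁y y≺₂x
    where
    x y : Pair
    x = 1 , suc B.Q
    y = suc B.P , 1
    key[x] : ∀ Q P R → Q * 1 + P * suc R ≡ (Q + P) + P * R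
    key[x] = solve-∀
    key[y] : ∀ Q P R → Q * suc R + P * 1 ≡ (Q + P) + Q * R
    key[y] = solve-∀
    x≺₁y : x A.≺ y
    x≺₁y = A.key< (subst₂ _<_ (sym (key[x] A.Q A.P B.Q)) (sym (key[y] A.Q A.P B.P))
      (ℕP.+-monoʳ-< (A.Q + A.P) P₁Q₂<Q₁P₂))
    y≺₂x : y B.≺ x
    y≺₂x = B.key≡ (begin
      B.key y                     ≡⟨ key[y] B.Q B.P B.P ⟩
      (B.Q + B.P) + B.Q * B.P     ≡⟨ cong (B.Q + B.P +_) (ℕP.*-comm B.Q B.P) ⟩
      (B.Q + B.P) + B.P * B.Q     ≡⟨ key[x] B.Q B.P B.Q ⟨
      B.key x                     ∎) (s≤s (s≤s z≤n))
      where open ≡-Reasoning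

-- Avoiding a finite list

Differ-sym : ∀ {T U} → Differ T U → Differ U T
Differ-sym (k , T≢U) = k , T≢U ∘ sym

PairwiseDistinct : (ℕ → Seq) → Set
PairwiseDistinct F = ∀ m m' → m ≢ m' → Differ (F m) (F m')

PairwiseDistinct-∘ : ∀ {F f} → PairwiseDistinct F → (∀ {m m'} → f m ≡ f m' → m ≡ m') →
  PairwiseDistinct (F ∘ f)
PairwiseDistinct-∘ distinct f-injective m m' m≢m' = distinct _ _ (m≢m' ∘ f-injective)

Differ-either : ∀ {T T'} → Differ T T' → ∀ U → Differ T U ⊎ Differ T' U
Differ-either {T} {T'} (k , T≢T') U with T k ℕ.≟ U k
... | no T≢U = inj₁ (k , T≢U)
... | yes T≡U = inj₂ (k , λ T'≡U → T≢T' (trans T≡U (sym T'≡U)))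

-- Of two members of the family, one avoids U; induct on the even- and odd-indexed halves.
avoiding : ∀ F → PairwiseDistinct F → (Us : List Seq) → ∃ λ m → All (Differ (F m)) Us
avoiding F distinct [] = 0 , []
avoiding F distinct (U ∷ Us)
  with avoiding (F ∘ (2 *_)) (PairwiseDistinct-∘ distinct (ℕP.*-cancelˡ-≡ _ _ 2)) Us
     | avoiding (F ∘ suc ∘ (2 *_))
         (PairwiseDistinct-∘ distinct (ℕP.*-cancelˡ-≡ _ _ 2 ∘ ℕP.suc-injective)) Us
... | a , Fa-avoids | b , Fb-avoids with Differ-either (distinct _ _ (ℕP.even≢odd a b)) U
...   | inj₁ Fa≢U = 2 * a , Fa≢U ∷ Fa-avoids
...   | inj₂ Fb≢U = suc (2 * b) , Fb≢U ∷ Fb-avoids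

-- The beginning of a doubly fractal sequence

record Enumerates (Pr : ℕ → Set) (f : ℕ → ℕ) : Set where
  field
    increasing : StrictlyIncreasing f
    members    : ∀ k → Pr (f k)
    complete   : ∀ i → Pr i → ∃ λ k → f k ≡ i

  mono-< : ∀ {h h'} → h < h' → f h < f h'
  mono-< {h} {suc h'} (s≤s h≤h') with ℕP.m≤n⇒m<n∨m≡n h≤h'
  ... | inj₁ h<h' = ℕP.<-trans (mono-< h<h') (increasing h')
  ... | inj₂ refl = increasing h

  mono-≤ : ∀ {h h'} → h ≤ h' → f h ≤ f h'
  mono-≤ h≤h' with ℕP.m≤n⇒m<n∨m≡n h≤h'
  ... | inj₁ h<h' = ℕP.<⇒≤ (mono-< h<h')
  ... | inj₂ refl = ℕP.≤-refl

  cancel-< : ∀ {h h'} → f h < f h' → h < h'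
  cancel-< {h} {h'} fh<fh' = ℕP.≰⇒> (λ h'≤h → ℕP.<⇒≱ fh<fh' (mono-≤ h'≤h))

  least : ∀ {p} → Pr p → (∀ q → q < p → ¬ Pr q) → f 0 ≡ p
  least {p} Pr[p] none-below with complete p Pr[p]
  ... | k , refl = ℕP.≤-antisym (mono-≤ z≤n) (ℕP.≮⇒≥ (λ f0<p → none-below (f 0) f0<p (members 0)))

  next : ∀ {k p} → f k < p → Pr p → (∀ q → f k < q → q < p → ¬ Pr q) → f (suc k) ≡ p
  next {k} {p} fk<p Pr[p] none-between with complete p Pr[p]
  ... | k' , refl = ℕP.≤-antisym (mono-≤ (cancel-< fk<p))
    (ℕP.≮⇒≥ (λ f[1+k]<p → none-between (f (suc k)) (increasing k) f[1+k]<p (members (suc k))))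

  adjacent : ∀ {k p} → f k ≡ p → Pr (suc p) → f (suc k) ≡ suc p
  adjacent refl Pr[1+p] = next ℕP.≤-refl Pr[1+p] (λ q fk<q q<1+fk _ → ℕP.<⇒≱ fk<q (ℕP.≤-pred q<1+fk))

  skip : ∀ {k p} → f k ≡ p → ¬ Pr (suc p) → Pr (suc (suc p)) → f (suc k) ≡ suc (suc p)
  skip {p = p} refl ¬Pr[1+p] Pr[2+p] = next (ℕP.m<n⇒m<1+n (ℕP.n<1+n p)) Pr[2+p] λ q p<q q<2+p →
    subst (¬_ ∘ Pr) (ℕP.≤-antisym p<q (ℕP.≤-pred q<2+p)) ¬Pr[1+p]

  from-one : ¬ Pr 0 → ∀ {L} → (∀ j → j < L → Pr (suc j)) → ∀ k → k < L → f k ≡ suc k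
  from-one ¬Pr[0] Pr[1+j] zero 0<L = least (Pr[1+j] 0 0<L) λ { zero _ → ¬Pr[0] ; (suc _) (s≤s ()) }
  from-one ¬Pr[0] Pr[1+j] (suc k) 1+k<L =
    adjacent (from-one ¬Pr[0] Pr[1+j] k (ℕP.<⇒≤ 1+k<L)) (Pr[1+j] (suc k) 1+k<L)

∸1≡⇒≡suc : ∀ {x v} → 1 ≤ x → x ∸ 1 ≡ v → x ≡ suc v
∸1≡⇒≡suc {suc _} _ refl = refl

≢1⇒2≤ : ∀ {x} → 1 ≤ x → x ≢ 1 → 2 ≤ x
≢1⇒2≤ {suc zero} _ x≢1 = contradiction refl x≢1
≢1⇒2≤ {suc (suc _)} _ _ = s≤s (s≤s z≤n)

2≤⇒≢1 : ∀ {x} → 2 ≤ x → x ≢ 1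
2≤⇒≢1 (s≤s ()) refl

module DoublyFractalStart {S : Seq} (doubly-fractal : DoublyFractal S) where
  private
    admissible : Admissible S
    admissible = proj₁ doubly-fractal
    upper-trim : UpperTrimEq S
    upper-trim = proj₁ (proj₂ (proj₂ doubly-fractal))
    lower-trim : LowerTrimEq S
    lower-trim = proj₂ (proj₂ (proj₂ doubly-fractal))

  S₀≡1 : S 0 ≡ 1
  S₀≡1 = proj₁ (proj₂ doubly-fractal)

  upper : ℕ → ℕ
  upper = proj₁ upper-trim

  lower : ℕ → ℕ
  lower = proj₁ lower-trim

  upper-enumerates : Enumerates (λ i → ¬ FirstOcc S i) upper
  upper-enumerates = record
    { increasing = proj₁ (proj₂ upper-trim)
    ; members    = proj₁ (proj₂ (proj₂ upper-trim))
    ; complete   = proj₁ (proj₂ (proj₂ (proj₂ upper-trim)))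
    }

  lower-enumerates : Enumerates (λ i → 2 ≤ S i) lower
  lower-enumerates = record
    { increasing = proj₁ (proj₂ lower-trim)
    ; members    = proj₁ (proj₂ (proj₂ lower-trim))
    ; complete   = proj₁ (proj₂ (proj₂ (proj₂ lower-trim)))
    }

  module U = Enumerates upper-enumerates
  module L = Enumerates lower-enumerates

  upper-copies : ∀ {k i} → upper k ≡ i → S i ≡ S k
  upper-copies {k} refl = proj₂ (proj₂ (proj₂ (proj₂ upper-trim))) k

  lower-raises : ∀ {k i} → lower k ≡ i → S i ≡ suc (S k)
  lower-raises {k} refl =
    ∸1≡⇒≡suc (ℕP.≤-trans (s≤s z≤n) (L.members k)) (proj₂ (proj₂ (proj₂ (proj₂ lower-trim))) k)

  ≢1⇒2≤S : ∀ i → S i ≢ 1 → 2 ≤ S i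
  ≢1⇒2≤S i = ≢1⇒2≤ (proj₁ admissible i)

  repeated : ∀ {k i} → k < i → S k ≡ S i → ¬ FirstOcc S i
  repeated k<i S[k]≡S[i] first = first _ k<i S[k]≡S[i]

  repeats-S₀ : ∀ {i} → 0 < i → S i ≡ 1 → ¬ FirstOcc S i
  repeats-S₀ 0<i S[i]≡1 = repeated 0<i (trans S₀≡1 (sym S[i]≡1))

  ¬2≤S₀ : ¬ 2 ≤ S 0
  ¬2≤S₀ 2≤S₀ = 2≤⇒≢1 2≤S₀ S₀≡1

  module _ {n'} (prefix : PrefixId S (suc (suc n')))
    (maximal : ∀ k → PrefixId S k → k ≤ suc (suc n')) where
    private
      N : ℕ
      N = suc (suc n')

    2≤S[1+j] : ∀ j → suc j < N → 2 ≤ S (suc j)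
    2≤S[1+j] j 1+j<N = subst (2 ≤_) (sym (prefix (suc j) 1+j<N)) (s≤s (s≤s z≤n))

    lower[n']≡1+n' : lower n' ≡ suc n'
    lower[n']≡1+n' = L.from-one ¬2≤S₀ (λ j j<1+n' → 2≤S[1+j] j (s≤s j<1+n')) n' ℕP.≤-refl

    -- Otherwise S₁, …, S_N ≥ 2, and the lower trim raises S_{N-1} = N to S_N = N + 1.
    S[N]≡1 : S N ≡ 1
    S[N]≡1 with S N ℕ.≟ 1
    ... | yes S[N]≡1 = S[N]≡1
    ... | no S[N]≢1 = contradiction (maximal (suc N) longer-prefix) (ℕP.<-irrefl refl)
      where
      Pr[1+j] : ∀ j → j < N → 2 ≤ S (suc j)
      Pr[1+j] j j<N with ℕP.m≤n⇒m<n∨m≡n j<N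
      ... | inj₁ 1+j<N = 2≤S[1+j] j 1+j<N
      ... | inj₂ refl = ≢1⇒2≤S N S[N]≢1
      longer-prefix : PrefixId S (suc N)
      longer-prefix j j<1+N with ℕP.m≤n⇒m<n∨m≡n (ℕP.≤-pred j<1+N)
      ... | inj₁ j<N = prefix j j<N
      ... | inj₂ refl = trans (lower-raises (L.from-one ¬2≤S₀ Pr[1+j] (suc n') ℕP.≤-refl))
                          (cong suc (prefix (suc n') ℕP.≤-refl))

    upper₀≡N : upper 0 ≡ N
    upper₀≡N = U.least (repeats-S₀ (s≤s z≤n) S[N]≡1) λ q q<N repeat → repeat (first q q<N)
      where
      first : ∀ q → q < N → FirstOcc S q
      first q q<N k k<q S[k]≡S[q] = ℕP.<-irrefl (ℕP.suc-injective (begin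
        suc k   ≡⟨ prefix k (ℕP.<-trans k<q q<N) ⟨
        S k     ≡⟨ S[k]≡S[q] ⟩
        S q     ≡⟨ prefix q q<N ⟩
        suc q   ∎)) k<q
        where open ≡-Reasoning

    2≤S[1+N] : 2 ≤ S (suc N)
    2≤S[1+N] = ≢1⇒2≤S (suc N) λ S[1+N]≡1 → 2≤⇒≢1 (s≤s (s≤s z≤n)) (begin
      2              ≡⟨ prefix 1 (s≤s (s≤s z≤n)) ⟨
      S 1            ≡⟨ upper-copies (U.adjacent upper₀≡N (repeats-S₀ (s≤s z≤n) S[1+N]≡1)) ⟨
      S (suc N)      ≡⟨ S[1+N]≡1 ⟩
      1              ∎)
      where open ≡-Reasoning

    S[1+N]≡1+N : S (suc N) ≡ suc N
    S[1+N]≡1+N = trans (lower-raises lower[1+n']≡1+N) (cong suc (prefix (suc n') ℕP.≤-refl))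
      where
      lower[1+n']≡1+N : lower (suc n') ≡ suc N
      lower[1+n']≡1+N = L.skip lower[n']≡1+n' (λ 2≤S[N] → 2≤⇒≢1 2≤S[N] S[N]≡1) 2≤S[1+N]

  increasing-start : ∀ {n} → S 1 ≢ 1 → PrefixId S n → (∀ k → PrefixId S k → k ≤ n) →
    ∃ λ n' → n ≡ suc (suc n') × S n ≡ 1 × S (suc n) ≡ suc n
  increasing-start S₁≢1 prefix maximal with maximal 2 prefix₂
    where
    lower₀≡1 : lower 0 ≡ 1
    lower₀≡1 = L.least (≢1⇒2≤S 1 S₁≢1) λ { zero _ → ¬2≤S₀ ; (suc _) (s≤s ()) }
    prefix₂ : PrefixId S 2
    prefix₂ zero _ = S₀≡1
    prefix₂ (suc zero) _ = trans (lower-raises lower₀≡1) (cong suc S₀≡1)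
    prefix₂ (suc (suc _)) (s≤s (s≤s ()))
  ... | s≤s (s≤s {n = n'} _) = n' , refl , S[N]≡1 prefix maximal , S[1+N]≡1+N prefix maximal

  module _ {n'} (ones : ∀ j → j < suc (suc n') → S j ≡ 1) (S[N]≢1 : S (suc (suc n')) ≢ 1) where
    private
      N : ℕ
      N = suc (suc n')

    lower₀≡N : lower 0 ≡ N
    lower₀≡N = L.least (≢1⇒2≤S N S[N]≢1) (λ q q<N 2≤S[q] → 2≤⇒≢1 2≤S[q] (ones q q<N))

    S[N]≡2 : S N ≡ 2
    S[N]≡2 = trans (lower-raises lower₀≡N) (cong suc S₀≡1)

    upper[n']≡1+n' : upper n' ≡ suc n'
    upper[n']≡1+n' = U.from-one (λ repeat → repeat (λ _ ()))
      (λ j j<1+n' → repeats-S₀ (s≤s z≤n) (ones (suc j) (s≤s j<1+n'))) n' ℕP.≤-refl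

    -- Otherwise S_{N+1} = 2 repeats S_N, and the upper trim copies S_{N-1} = 1 to S_{N+1}.
    S[1+N]≡1 : S (suc N) ≡ 1
    S[1+N]≡1 with S (suc N) ℕ.≟ 1
    ... | yes S[1+N]≡1 = S[1+N]≡1
    ... | no S[1+N]≢1 =
      contradiction (trans (upper-copies upper[1+n']≡1+N) (ones (suc n') ℕP.≤-refl)) S[1+N]≢1
      where
      S[1+N]≡2 : S (suc N) ≡ 2
      S[1+N]≡2 = trans (lower-raises (L.adjacent lower₀≡N (≢1⇒2≤S (suc N) S[1+N]≢1)))
                   (cong suc (ones 1 (s≤s (s≤s z≤n))))
      first-N : FirstOcc S N
      first-N k k<N S[k]≡S[N] with trans (sym (ones k k<N)) (trans S[k]≡S[N] S[N]≡2)
      ... | ()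
      upper[1+n']≡1+N : upper (suc n') ≡ suc N
      upper[1+n']≡1+N = U.skip upper[n']≡1+n' (λ repeat → repeat first-N)
        (repeated ℕP.≤-refl (trans S[N]≡2 (sym S[1+N]≡2)))

  constant-start : ∀ {n} → S 1 ≡ 1 → (∀ j → j < n → S j ≡ 1) → S n ≢ 1 →
    ∃ λ n' → n ≡ suc (suc n') × S n ≡ 2 × S (suc n) ≡ 1
  constant-start {zero} _ _ S₀≢1 = contradiction S₀≡1 S₀≢1
  constant-start {suc zero} S₁≡1 _ S₁≢1 = contradiction S₁≡1 S₁≢1
  constant-start {suc (suc n')} _ ones S[N]≢1 =
    n' , refl , S[N]≡2 ones S[N]≢1 , S[1+N]≡1 ones S[N]≢1

-- A family of slopes just above N - 1

n≡1+m+o⇒m<n : ∀ {m n} o → n ≡ suc m + o → m < n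
n≡1+m+o⇒m<n {m} o refl = ℕP.m≤m+n (suc m) o

-- Keys Q i + P j of the first few pairs, for Q = m + 2, P = (n' + 1) Q + 1 and N = n' + 2.
key[1,2]≡1+key[N,1] : ∀ n' m → let Q = suc (suc m); P = suc (suc n' * Q) in
  Q * 1 + P * 2 ≡ suc (Q * suc (suc n') + P * 1)
key[1,2]≡1+key[N,1] = solve-∀

key[1+N,1]≡key[1,2]+1+m : ∀ n' m → let Q = suc (suc m); P = suc (suc n' * Q) in
  Q * suc (suc (suc n')) + P * 1 ≡ (Q * 1 + P * 2) + suc m
key[1+N,1]≡key[1,2]+1+m = solve-∀

key[2+a,2]≡1+key[1+N,1]+Qa : ∀ n' m a → let Q = suc (suc m); P = suc (suc n' * Q) in
  Q * suc (suc a) + P * 2 ≡ suc (Q * suc (suc (suc n')) + P * 1) + Q * a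
key[2+a,2]≡1+key[1+N,1]+Qa = solve-∀

key[1+a,3+b]≡1+key[1+N,1]+d : ∀ n' m a b → let Q = suc (suc m); P = suc (suc n' * Q) in
  Q * suc a + P * suc (suc (suc b))
    ≡ suc (Q * suc (suc (suc n')) + P * 1) + (Q * a + P * b + suc (n' * Q))
key[1+a,3+b]≡1+key[1+N,1]+d = solve-∀

module Opening (n' : ℕ) where
  N : ℕ
  N = suc (suc n')

  -- fraction (slope-p m) (slope-q m) is θₘ = (N - 1) + 1 / (m + 2).
  slope-p slope-q : ℕ → ℕ
  slope-p m = suc n' * suc (suc m)
  slope-q m = suc m

  module E (m : ℕ) = Enumeration (slope-p m) (slope-q m)

  signature₁ : ∀ m → IsSignatureSequence (proj₁ ∘ E.e m)
  signature₁ m = fraction (slope-p m) (slope-q m) , E.signature₁ m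

  signature₂ : ∀ m → IsSignatureSequence (proj₂ ∘ E.e m)
  signature₂ m = fraction (slope-q m) (slope-p m) , E.signature₂ m

  opening : ℕ → Pair
  opening h with h ℕ.<? N
  ... | yes _ = suc h , 1
  ... | no _ with h ℕ.≟ N
  ...   | yes _ = 1 , 2
  ...   | no _ = h , 1

  opening-< : ∀ {h} → h < N → opening h ≡ (suc h , 1)
  opening-< {h} h<N with h ℕ.<? N
  ... | yes _ = refl
  ... | no h≮N = contradiction h<N h≮N

  opening-N : opening N ≡ (1 , 2)
  opening-N with N ℕ.<? N
  ... | yes N<N = contradiction N<N (ℕP.<-irrefl refl)
  ... | no _ with N ℕ.≟ N
  ...   | yes _ = refl
  ...   | no N≢N = contradiction refl N≢N

  opening-1+N : opening (suc N) ≡ (suc N , 1)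
  opening-1+N with suc N ℕ.<? N
  ... | yes 1+N<N = contradiction 1+N<N (ℕP.<-asym (ℕP.n<1+n N))
  ... | no _ with suc N ℕ.≟ N
  ...   | yes 1+N≡N = contradiction 1+N≡N (ℕP.1+n≢n)
  ...   | no _ = refl

  ≤1+N-cases : ∀ {h} → h ≤ suc N → h < N ⊎ h ≡ N ⊎ h ≡ suc N
  ≤1+N-cases h≤1+N with ℕP.m≤n⇒m<n∨m≡n h≤1+N
  ... | inj₂ h≡1+N = inj₂ (inj₂ h≡1+N)
  ... | inj₁ (s≤s h≤N) with ℕP.m≤n⇒m<n∨m≡n h≤N
  ...   | inj₁ h<N = inj₁ h<N
  ...   | inj₂ h≡N = inj₂ (inj₁ h≡N)

  opening-pos : ∀ h → h ≤ suc N → PosPair (opening h)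
  opening-pos h h≤1+N with ≤1+N-cases h≤1+N
  ... | inj₁ h<N = subst PosPair (sym (opening-< h<N)) (s≤s z≤n , s≤s z≤n)
  ... | inj₂ (inj₁ refl) = subst PosPair (sym opening-N) (s≤s z≤n , s≤s z≤n)
  ... | inj₂ (inj₂ refl) = subst PosPair (sym opening-1+N) (s≤s z≤n , s≤s z≤n)

  module _ (m : ℕ) where
    open E m

    [N,1]≺[1,2] : (N , 1) ≺ (1 , 2)
    [N,1]≺[1,2] = key< (ℕP.≤-reflexive (sym (key[1,2]≡1+key[N,1] n' m)))

    [1,2]≺[1+N,1] : (1 , 2) ≺ (suc N , 1)
    [1,2]≺[1+N,1] = key< (subst (key (1 , 2) <_) (sym (key[1+N,1]≡key[1,2]+1+m n' m))
      (ℕP.m<m+n _ (s≤s z≤n)))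

    opening-sorted : ∀ h → h < suc N → opening h ≺ opening (suc h)
    opening-sorted h (s≤s h≤N) with ℕP.m≤n⇒m<n∨m≡n h≤N
    ... | inj₂ refl = subst₂ _≺_ (sym opening-N) (sym opening-1+N) [1,2]≺[1+N,1]
    ... | inj₁ h<N with ℕP.m≤n⇒m<n∨m≡n h<N
    ...   | inj₁ 1+h<N =
      subst₂ _≺_ (sym (opening-< h<N)) (sym (opening-< 1+h<N)) (proj₁<⇒≺ refl ℕP.≤-refl)
    ...   | inj₂ refl = subst₂ _≺_ (sym (opening-< h<N)) (sym opening-N) [N,1]≺[1,2]

    below-[1+N,1] : ∀ z → PosPair z → z ≼ (suc N , 1) → ∃ λ i → i ≤ suc N × opening i ≡ z
    below-[1+N,1] (zero , _) (() , _) _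
    below-[1+N,1] (_ , zero) (_ , ()) _
    below-[1+N,1] (suc a , 1) _ z≼ with a ℕ.<? N
    ... | yes a<N = a , ℕP.≤-trans (ℕP.<⇒≤ a<N) (ℕP.n≤1+n N) , opening-< a<N
    ... | no a≮N = suc N , ℕP.≤-refl , trans opening-1+N (cong (λ i → suc i , 1) N≡a)
      where
      N≡a : N ≡ a
      N≡a = ℕP.≤-antisym (ℕP.≮⇒≥ a≮N) (ℕP.≤-pred (≼⇒proj₁≤ refl z≼))
    below-[1+N,1] (1 , 2) _ _ = N , ℕP.n≤1+n N , opening-N
    below-[1+N,1] (suc (suc a) , 2) _ z≼ =
      ⊥-elim (ℕP.<⇒≱ (n≡1+m+o⇒m<n (suc (suc m) * a) (key[2+a,2]≡1+key[1+N,1]+Qa n' m a)) (≼⇒key≤ z≼))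
    below-[1+N,1] (suc a , suc (suc (suc b))) _ z≼ =
      ⊥-elim (ℕP.<⇒≱ (n≡1+m+o⇒m<n _ (key[1+a,3+b]≡1+key[1+N,1]+d n' m a b)) (≼⇒key≤ z≼))

    e-opening : ∀ h → h ≤ suc N → e h ≡ opening h
    e-opening = e-initial opening (suc N) (opening-< (s≤s z≤n)) opening-pos opening-sorted
      (λ {z} z⁺ z≼ → below-[1+N,1] z z⁺ (subst (z ≼_) opening-1+N z≼))

  opening-agrees : (T : Pair → ℕ) (S : Seq) → (∀ j → j < N → S j ≡ T (suc j , 1)) →
    S N ≡ T (1 , 2) → S (suc N) ≡ T (suc N , 1) → ∀ m → AgreeBelow (N + 2) (T ∘ E.e m) S
  opening-agrees T S S<N S[N] S[1+N] m j j<N+2 =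
    agree-at j (ℕP.≤-pred (subst (j <_) (ℕP.+-comm N 2) j<N+2))
    where
    agree-at : ∀ j → j ≤ suc N → T (E.e m j) ≡ S j
    agree-at j j≤1+N with ≤1+N-cases j≤1+N
    ... | inj₁ j<N = trans (cong T (trans (e-opening m j j≤1+N) (opening-< j<N))) (sym (S<N j j<N))
    ... | inj₂ (inj₁ refl) = trans (cong T (trans (e-opening m N j≤1+N) opening-N)) (sym S[N])
    ... | inj₂ (inj₂ refl) = trans (cong T (trans (e-opening m (suc N) j≤1+N) opening-1+N)) (sym S[1+N])

  slope-decreasing : ∀ {m m'} → m < m' →
    suc (slope-p m') * suc (slope-q m) < suc (slope-q m') * suc (slope-p m)
  slope-decreasing {m} {m'} m<m' = ℕP.+-cancelʳ-< Q' (P' * Q) (Q' * P) (begin-strict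
    P' * Q + Q'   ≡⟨ cross n' m m' ⟩
    Q' * P + Q    <⟨ ℕP.+-monoʳ-< (Q' * P) (s≤s (s≤s m<m')) ⟩
    Q' * P + Q'   ∎)
    where
    open ℕP.≤-Reasoning
    Q Q' P P' : ℕ
    Q = suc (suc m)
    Q' = suc (suc m')
    P = suc (suc n' * Q)
    P' = suc (suc n' * Q')
    cross : ∀ n' m m' → suc (suc n' * suc (suc m')) * suc (suc m) + suc (suc m')
                      ≡ suc (suc m') * suc (suc n' * suc (suc m)) + suc (suc m)
    cross = solve-∀

  opening-distinct : ∀ {π} → Coherent π → ∀ m m' → m ≢ m' → Differ (π ∘ E.e m) (π ∘ E.e m')
  opening-distinct coherent m m' m≢m' with ℕP.<-cmp m m'
  ... | tri< m<m' _ _ = Differ-sym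
    (fractions-differ coherent (slope-p m') (slope-q m') (slope-p m) (slope-q m) (slope-decreasing m<m'))
  ... | tri≈ _ m≡m' _ = contradiction m≡m' m≢m'
  ... | tri> _ _ m>m' =
    fractions-differ coherent (slope-p m) (slope-q m) (slope-p m') (slope-q m') (slope-decreasing m>m')

  shared-opening : ∀ {π} → Coherent π → (∀ m → IsSignatureSequence (π ∘ E.e m)) → ∀ S →
    (∀ j → j < N → S j ≡ π (suc j , 1)) → S N ≡ π (1 , 2) → S (suc N) ≡ π (suc N , 1) →
    ∀ Us → Σ Seq λ T → IsSignatureSequence T × AgreeBelow (N + 2) T S × All (Differ T) Us
  shared-opening {π} coherent signature S S<N S[N] S[1+N] Us
    with avoiding (λ m → π ∘ E.e m) (opening-distinct coherent) Us
  ... | m , avoids = π ∘ E.e m , signature m , opening-agrees π S S<N S[N] S[1+N] m , avoids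

lemma10 : (S : Seq) → DoublyFractal S → (n : ℕ) → TheN S n →
    (Us : List Seq) →
    Σ Seq (λ T → IsSignatureSequence T × AgreeBelow (n + 2) T S × All (Differ T) Us)
lemma10 S doubly-fractal n (inj₁ (S₁≢1 , prefix , maximal)) Us
  with DoublyFractalStart.increasing-start doubly-fractal S₁≢1 prefix maximal
... | n' , refl , S[N]≡1 , S[1+N]≡1+N = Opening.shared-opening n' proj₁-coherent
  (Opening.signature₁ n') S prefix S[N]≡1 S[1+N]≡1+N Us
lemma10 S doubly-fractal n (inj₂ (S₁≡1 , ones , S[n]≢1)) Us
  with DoublyFractalStart.constant-start doubly-fractal S₁≡1 ones S[n]≢1
... | n' , refl , S[N]≡2 , S[1+N]≡1 = Opening.shared-opening n' proj₂-coherent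
  (Opening.signature₂ n') S ones S[N]≡2 S[1+N]≡1 Us
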